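{- For any $n,m\geq 2$ and $k\geq 2$, if $n$ divides $m$ then $\mathsf{HT}^{=n}_k$ is strongly computably reducible to $\mathsf{HT}^{=m}_k$.
   Context: $\mathbb{N}$ denotes the positive integers. $\mathrm{FS}^{=n}(H)$ is the set of sums of exactly $n$ distinct elements of $H$. $\mathsf{HT}^{=n}_k$: for every $f:\mathbb{N}\to k$ there is an infinite $H\subseteq\mathbb{N}$ with $\mathrm{FS}^{=n}(H)$ monochromatic for $f$. $\mathsf{Q}$ is strongly computably reducible to $\mathsf{P}$ if for every instance $I$ of $\mathsf{Q}$ there is an instance $J$ of $\mathsf{P}$ computable from $I$ such that every solution of $J$ computes a solution of $I$. -}

module Defs where

open import Data.Nat using (ℕ; zero; suc; _+_; _<_; _≤_)
open import Data.Fin using (Fin; toℕ)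
open import Data.Vec using (Vec; []; _∷_; lookup)
open import Data.Unit using (⊤)
open import Data.Bool using (Bool; true; false)
open import Data.Product using (Σ; ∃; ∃-syntax; _×_; _,_)
open import Relation.Binary.PropositionalEquality using (_≡_)

-- Oracle computability: Kleene's partial recursive functions relative
-- to an oracle O : ℕ → ℕ (equivalent to oracle Turing machines).

data Code : ℕ → Set where
  zeroC   : ∀ {n} → Code n
  succC   : Code 1
  projC   : ∀ {n} → Fin n → Code n
  oracleC : Code 1
  compC   : ∀ {m n} → Code m → Vec (Code n) m → Code n
  precC   : ∀ {n} → Code n → Code (suc (suc n)) → Code (suc n)
  muC     : ∀ {n} → Code (suc n) → Code n

mutual
  data Eval (O : ℕ → ℕ) : ∀ {n} → Code n → Vec ℕ n → ℕ → Set where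
    evZero   : ∀ {n} {xs : Vec ℕ n} → Eval O zeroC xs 0
    evSucc   : ∀ {x} → Eval O succC (x ∷ []) (suc x)
    evProj   : ∀ {n} {i : Fin n} {xs} → Eval O (projC i) xs (lookup xs i)
    evOracle : ∀ {x} → Eval O oracleC (x ∷ []) (O x)
    evComp   : ∀ {m n} {f : Code m} {gs : Vec (Code n) m} {xs ys y} →
               EvalVec O gs xs ys → Eval O f ys y → Eval O (compC f gs) xs y
    evPrec0  : ∀ {n} {f : Code n} {g} {xs y} →
               Eval O f xs y → Eval O (precC f g) (0 ∷ xs) y
    evPrecS  : ∀ {n} {f : Code n} {g} {xs t r y} →
               Eval O (precC f g) (t ∷ xs) r → Eval O g (t ∷ r ∷ xs) y →
               Eval O (precC f g) (suc t ∷ xs) y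
    evMu     : ∀ {n} {f : Code (suc n)} {xs y} →
               Eval O f (y ∷ xs) 0 →
               (∀ z → z < y → ∃[ v ] Eval O f (z ∷ xs) (suc v)) →
               Eval O (muC f) xs y

  data EvalVec (O : ℕ → ℕ) {n : ℕ} : ∀ {m} → Vec (Code n) m → Vec ℕ n → Vec ℕ m → Set where
    evNil  : ∀ {xs} → EvalVec O [] xs []
    evCons : ∀ {m} {g} {gs : Vec (Code n) m} {xs y ys} →
             Eval O g xs y → EvalVec O gs xs ys → EvalVec O (g ∷ gs) xs (y ∷ ys)

_≤T_ : (ℕ → ℕ) → (ℕ → ℕ) → Set
B ≤T A = ∃[ e ] (∀ x → Eval A e (x ∷ []) (B x))

encColor : ∀ {k} → (ℕ → Fin k) → ℕ → ℕ
encColor f x = toℕ (f x)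

χ : (ℕ → Bool) → ℕ → ℕ
χ H x with H x
... | true  = 1
... | false = 0

-- subsets of the positive integers, given by characteristic functions
-- (membership of 0 is excluded below)
_∈S_ : ℕ → (ℕ → Bool) → Set
x ∈S H = H x ≡ true

Infinite : (ℕ → Bool) → Set
Infinite H = ∀ a → ∃[ b ] (a < b × b ∈S H)

data StrictlyIncreasing : ∀ {n} → Vec ℕ n → Set where
  si[]  : StrictlyIncreasing []
  si[x] : ∀ {x} → StrictlyIncreasing (x ∷ [])
  si∷   : ∀ {n x y} {ys : Vec ℕ n} → x < y →
          StrictlyIncreasing (y ∷ ys) → StrictlyIncreasing (x ∷ y ∷ ys)

AllIn : ∀ {n} → Vec ℕ n → (ℕ → Bool) → Set
AllIn []       H = ⊤
AllIn (x ∷ xs) H = x ∈S H × AllIn xs H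

vsum : ∀ {n} → Vec ℕ n → ℕ
vsum []       = 0
vsum (x ∷ xs) = x + vsum xs

-- s ∈ FS^{=n}(H): s is a sum of exactly n distinct elements of H
-- (listed in strictly increasing order)
InFS= : ℕ → (ℕ → Bool) → ℕ → Set
InFS= n H s = ∃[ xs ] (StrictlyIncreasing {n} xs × AllIn xs H × vsum xs ≡ s)

IsHTSolution : ∀ {k} → ℕ → (ℕ → Fin k) → (ℕ → Bool) → Set
IsHTSolution {k} n f H =
  (H 0 ≡ false) × Infinite H × ∃[ c ] (∀ s → InFS= n H s → f s ≡ c)

HTStrongReduces : ℕ → ℕ → ℕ → Set
HTStrongReduces k n m =
  ∀ (f : ℕ → Fin k) →
    Σ (ℕ → Fin k) λ g → (encColor g ≤T encColor f ×
      (∀ (H : ℕ → Bool) → IsHTSolution m g H →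
         Σ (ℕ → Bool) λ H' → (IsHTSolution n f H' × χ H' ≤T χ H)))

-- The reduction leaves the colouring unchanged. Write m = n (d + 1) and let
-- e 0 < e 1 < ... enumerate a solution H of the m-instance; then e is
-- computable from H. Group the enumeration into consecutive blocks of d + 1
-- elements and let H' be the set of block sums. The block sums are strictly
-- increasing, so H' is computable from H, and a sum of n distinct block sums
-- is a sum of n (d + 1) = m distinct elements of H; hence FS^{=n}(H') lies
-- inside FS^{=m}(H) and is monochromatic.

module Submission where

open import Defs
open import Data.Nat using (ℕ; zero; suc; _+_; _*_; _∸_; _≤_; _<_; _≟_; _<ᵇ_; z≤n; s≤s; pred)
open import Data.Nat.Properties
open import Data.Nat.Divisibility using (_∣_; divides)
open import Data.Fin using (Fin) renaming (zero to fzero; suc to fsuc)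
open import Data.Vec using (Vec; []; _∷_; lookup; map; _++_)
open import Data.Vec.Properties using (map-++)
open import Data.Unit using (⊤; tt)
open import Data.Bool using (Bool; true; false)
open import Data.Bool.Properties using (¬-not; T-≡)
open import Data.Sum using (inj₁; inj₂)
open import Data.Product using (Σ; ∃; ∃-syntax; _×_; _,_; proj₁; proj₂)
open import Function using (_∘_)
open import Function.Bundles using (Equivalence)
open import Relation.Nullary using (yes; no; contradiction)
open import Relation.Binary using (tri<; tri≈; tri>)
open import Relation.Binary.PropositionalEquality

unary : (ℕ → ℕ) → Vec ℕ 1 → ℕ
unary f xs = f (lookup xs fzero)

binary : (ℕ → ℕ → ℕ) → Vec ℕ 2 → ℕ
binary f xs = f (lookup xs fzero) (lookup xs (fsuc fzero))

sumBelow : (ℕ → ℕ) → ℕ → ℕ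
sumBelow f zero    = 0
sumBelow f (suc l) = sumBelow f l + f l

IsLeastZero : (ℕ → ℕ) → ℕ → Set
IsLeastZero F y = F y ≡ 0 × (∀ z → z < y → F z ≢ 0)

leastZero : (F : ℕ → ℕ) (b : ℕ) → F b ≡ 0 → ∃ (IsLeastZero F)
leastZero F zero    Fb≡0 = 0 , Fb≡0 , λ _ ()
leastZero F (suc b) Fb≡0 with F 0 ≟ 0
... | yes F0≡0 = 0 , F0≡0 , λ _ ()
... | no  F0≢0 with leastZero (F ∘ suc) b Fb≡0
...   | y , Fy≡0 , below = suc y , Fy≡0 , λ { zero _ → F0≢0 ; (suc z) (s≤s z<y) → below z z<y }

module Computability (O : ℕ → ℕ) where

  Computable : (n : ℕ) → (Vec ℕ n → ℕ) → Set
  Computable n F = Σ (Code n) λ c → ∀ xs → Eval O c xs (F xs)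

  ComputableVec : (n m : ℕ) → (Vec ℕ n → Vec ℕ m) → Set
  ComputableVec n m G = Σ (Vec (Code n) m) λ cs → ∀ xs → EvalVec O cs xs (G xs)

  computable-cong : ∀ {n F G} → Computable n F → (∀ xs → F xs ≡ G xs) → Computable n G
  computable-cong (c , ev) F≡G = c , λ xs → subst (Eval O c xs) (F≡G xs) (ev xs)

  Computable⇒≤T : ∀ {B} → Computable 1 (unary B) → B ≤T O
  Computable⇒≤T (c , ev) = c , λ x → ev (x ∷ [])

  zeroᶜ : ∀ {n} → Computable n (λ _ → 0)
  zeroᶜ = zeroC , λ _ → evZero

  sucᶜ : Computable 1 (unary suc)
  sucᶜ = succC , λ { (x ∷ []) → evSucc }

  projᶜ : ∀ {n} (i : Fin n) → Computable n (λ xs → lookup xs i)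
  projᶜ i = projC i , λ _ → evProj

  oracleᶜ : Computable 1 (unary O)
  oracleᶜ = oracleC , λ { (x ∷ []) → evOracle }

  []ᶜ : ∀ {n} → ComputableVec n 0 (λ _ → [])
  []ᶜ = [] , λ _ → evNil

  _∷ᶜ_ : ∀ {n m F G} → Computable n F → ComputableVec n m G →
         ComputableVec n (suc m) (λ xs → F xs ∷ G xs)
  (c , ev) ∷ᶜ (cs , evs) = c ∷ cs , λ xs → evCons (ev xs) (evs xs)

  infixr 5 _∷ᶜ_

  composeᶜ : ∀ {n m F G} → Computable m F → ComputableVec n m G → Computable n (F ∘ G)
  composeᶜ (c , ev) (cs , evs) = compC c cs , λ xs → evComp (evs xs) (ev _)

  compose₁ : ∀ {n F A} → Computable 1 F → Computable n A → Computable n (λ xs → F (A xs ∷ []))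
  compose₁ f a = composeᶜ f (a ∷ᶜ []ᶜ)

  compose₂ : ∀ {n F A B} → Computable 2 F → Computable n A → Computable n B →
             Computable n (λ xs → F (A xs ∷ B xs ∷ []))
  compose₂ f a b = composeᶜ f (a ∷ᶜ b ∷ᶜ []ᶜ)

  primRec : ∀ {n F G} → Computable n F → Computable (suc (suc n)) G →
            (P : Vec ℕ (suc n) → ℕ) →
            (∀ xs → P (0 ∷ xs) ≡ F xs) →
            (∀ t xs → P (suc t ∷ xs) ≡ G (t ∷ P (t ∷ xs) ∷ xs)) →
            Computable (suc n) P
  primRec {n} (f , evf) (g , evg) P P0 PS = precC f g , go
    where
    go : ∀ xs → Eval O (precC f g) xs (P xs)
    go (zero  ∷ xs) = subst (Eval O _ _) (sym (P0 xs)) (evPrec0 (evf xs))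
    go (suc t ∷ xs) = subst (Eval O _ _) (sym (PS t xs)) (evPrecS (go (t ∷ xs)) (evg _))

  minimise : ∀ {n F} → Computable (suc n) F → (G : Vec ℕ n → ℕ) →
             (∀ xs → IsLeastZero (λ y → F (y ∷ xs)) (G xs)) → Computable n G
  minimise {F = F} (c , ev) G least =
    muC c , λ xs → evMu (subst (Eval O c _) (proj₁ (least xs)) (ev _))
                        (λ z z<G → positive (ev (z ∷ xs)) (proj₂ (least xs) z z<G))
    where
    positive : ∀ {xs v} → Eval O c xs v → v ≢ 0 → ∃[ w ] Eval O c xs (suc w)
    positive {v = zero}  _  v≢0 = contradiction refl v≢0
    positive {v = suc w} ev _   = w , ev

  constᶜ : ∀ {n} c → Computable n (λ _ → c)
  constᶜ zero    = zeroᶜ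
  constᶜ (suc c) = compose₁ sucᶜ (constᶜ c)

  predᶜ : Computable 1 (unary pred)
  predᶜ = primRec zeroᶜ (projᶜ fzero) (unary pred) (λ _ → refl) (λ _ _ → refl)

  addᶜ : Computable 2 (binary _+_)
  addᶜ = primRec (projᶜ fzero) (compose₁ sucᶜ (projᶜ (fsuc fzero))) (binary _+_)
           (λ { (_ ∷ []) → refl }) (λ { _ (_ ∷ []) → refl })

  -- the recursion is on the subtrahend, which therefore comes first
  monusᶜ : Computable 2 (binary λ b a → a ∸ b)
  monusᶜ = primRec (projᶜ fzero) (compose₁ predᶜ (projᶜ (fsuc fzero))) (binary λ b a → a ∸ b)
             (λ { (_ ∷ []) → refl }) (λ { t (a ∷ []) → sym (pred[m∸n]≡m∸[1+n] a t) })

  mulᶜ : Computable 2 (binary _*_)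
  mulᶜ = primRec zeroᶜ (compose₂ addᶜ (projᶜ (fsuc (fsuc fzero))) (projᶜ (fsuc fzero))) (binary _*_)
           (λ { (_ ∷ []) → refl }) (λ { _ (_ ∷ []) → refl })

  _+ᶜ_ : ∀ {n A B} → Computable n A → Computable n B → Computable n (λ xs → A xs + B xs)
  a +ᶜ b = compose₂ addᶜ a b

  _∸ᶜ_ : ∀ {n A B} → Computable n A → Computable n B → Computable n (λ xs → A xs ∸ B xs)
  a ∸ᶜ b = compose₂ monusᶜ b a

  _*ᶜ_ : ∀ {n A B} → Computable n A → Computable n B → Computable n (λ xs → A xs * B xs)
  a *ᶜ b = compose₂ mulᶜ a b

  infixl 6 _+ᶜ_ _∸ᶜ_
  infixl 7 _*ᶜ_

  sumBelowᶜ : ∀ {F} → Computable 2 (binary F) →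
              Computable 2 (binary λ l x → sumBelow (λ i → F i x) l)
  sumBelowᶜ f = primRec zeroᶜ
                  (projᶜ (fsuc fzero) +ᶜ compose₂ f (projᶜ fzero) (projᶜ (fsuc (fsuc fzero))))
                  _ (λ { (_ ∷ []) → refl }) (λ { _ (_ ∷ []) → refl })

module IncreasingSequence {f : ℕ → ℕ} (f-suc : ∀ i → f i < f (suc i)) where

  mono-< : ∀ {i j} → i < j → f i < f j
  mono-< {i} {suc j} (s≤s i≤j) with m≤n⇒m<n∨m≡n i≤j
  ... | inj₁ i<j  = <-trans (mono-< i<j) (f-suc j)
  ... | inj₂ refl = f-suc j

  mono-≤ : ∀ {i j} → i ≤ j → f i ≤ f j
  mono-≤ i≤j with m≤n⇒m<n∨m≡n i≤j
  ... | inj₁ i<j  = <⇒≤ (mono-< i<j)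
  ... | inj₂ refl = ≤-refl

  cancel-< : ∀ {i j} → f i < f j → i < j
  cancel-< {i} {j} fi<fj with <-cmp i j
  ... | tri< i<j _ _ = i<j
  ... | tri≈ _ refl _ = contradiction fi<fj (<-irrefl refl)
  ... | tri> _ _ j<i = contradiction fi<fj (<-asym (mono-< j<i))

  n≤f[n] : ∀ n → n ≤ f n
  n≤f[n] zero    = z≤n
  n≤f[n] (suc n) = ≤-<-trans (n≤f[n] n) (f-suc n)

sumBelow-cong : ∀ {f g} → (∀ i → f i ≡ g i) → ∀ l → sumBelow f l ≡ sumBelow g l
sumBelow-cong f≡g zero    = refl
sumBelow-cong f≡g (suc l) = cong₂ _+_ (sumBelow-cong f≡g l) (f≡g l)

sumBelow-mono-≤ : ∀ {f g} → (∀ i → f i ≤ g i) → ∀ l → sumBelow f l ≤ sumBelow g l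
sumBelow-mono-≤ f≤g zero    = z≤n
sumBelow-mono-≤ f≤g (suc l) = +-mono-≤ (sumBelow-mono-≤ f≤g l) (f≤g l)

sumBelow-suc : ∀ f l → sumBelow f (suc l) ≡ f 0 + sumBelow (f ∘ suc) l
sumBelow-suc f zero    = +-comm 0 (f 0)
sumBelow-suc f (suc l) = begin
  sumBelow f (suc l) + f (suc l)            ≡⟨ cong (_+ f (suc l)) (sumBelow-suc f l) ⟩
  f 0 + sumBelow (f ∘ suc) l + f (suc l)    ≡⟨ +-assoc (f 0) _ _ ⟩
  f 0 + sumBelow (f ∘ suc) (suc l)          ∎
  where open ≡-Reasoning

sumBelow-positive : ∀ {f j} l → j < l → 0 < f j → 0 < sumBelow f l
sumBelow-positive (suc l) (s≤s j≤l) 0<fj with m≤n⇒m<n∨m≡n j≤l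
... | inj₁ j<l  = ≤-trans (sumBelow-positive l j<l 0<fj) (m≤m+n _ _)
... | inj₂ refl = ≤-trans 0<fj (m≤n+m _ _)

sumBelow-positive⁻ : ∀ f l → 0 < sumBelow f l → ∃[ j ] 0 < f j
sumBelow-positive⁻ f (suc l) 0<Σ with f l ≟ 0
... | no  fl≢0 = l , n≢0⇒n>0 fl≢0
... | yes fl≡0 =
  sumBelow-positive⁻ f l (subst (0 <_) (trans (cong (sumBelow f l +_) fl≡0) (+-identityʳ _)) 0<Σ)

δ : ℕ → ℕ → ℕ
δ a b = 1 ∸ ((a ∸ b) + (b ∸ a))

δ-refl : ∀ a → δ a a ≡ 1
δ-refl a rewrite n∸n≡0 a = refl

δ-positive⇒≡ : ∀ a b → 0 < δ a b → a ≡ b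
δ-positive⇒≡ a b 0<δ with (a ∸ b) + (b ∸ a) in eq
... | zero  = ≤-antisym (m∸n≡0⇒m≤n (m+n≡0⇒m≡0 _ eq)) (m∸n≡0⇒m≤n (m+n≡0⇒n≡0 (a ∸ b) eq))
... | suc w = contradiction (subst (0 <_) (0∸n≡0 w) 0<δ) λ ()

χ-true : ∀ G x → x ∈S G → χ G x ≡ 1
χ-true G x x∈G rewrite x∈G = refl

1∸χ≡0⇒∈ : ∀ G x → 1 ∸ χ G x ≡ 0 → x ∈S G
1∸χ≡0⇒∈ G x with G x
... | true  = λ _ → refl
... | false = λ ()

χ-<ᵇ : ∀ G x c → G x ≡ (0 <ᵇ c) → χ G x ≡ 1 ∸ (1 ∸ c)
χ-<ᵇ G x zero    Gx≡ rewrite Gx≡ = refl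
χ-<ᵇ G x (suc c) Gx≡ rewrite Gx≡ | 0∸n≡0 c = refl

IncreasingFrom : ∀ {l} → ℕ → Vec ℕ l → Set
IncreasingFrom lo []       = ⊤
IncreasingFrom lo (x ∷ xs) = lo ≤ x × IncreasingFrom (suc x) xs

IncreasingFrom-weaken : ∀ {l lo lo'} (xs : Vec ℕ l) → lo ≤ lo' →
                        IncreasingFrom lo' xs → IncreasingFrom lo xs
IncreasingFrom-weaken []       _      _            = tt
IncreasingFrom-weaken (x ∷ xs) lo≤lo' (lo'≤x , inc) = ≤-trans lo≤lo' lo'≤x , inc

IncreasingFrom⇒StrictlyIncreasing : ∀ {l lo} (xs : Vec ℕ l) → IncreasingFrom lo xs → StrictlyIncreasing xs
IncreasingFrom⇒StrictlyIncreasing []           _                   = si[]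
IncreasingFrom⇒StrictlyIncreasing (x ∷ [])     _                   = si[x]
IncreasingFrom⇒StrictlyIncreasing (x ∷ y ∷ xs) (_ , x<y , inc) =
  si∷ x<y (IncreasingFrom⇒StrictlyIncreasing (y ∷ xs) (x<y , inc))

StrictlyIncreasing⇒IncreasingFrom : ∀ {l x} {xs : Vec ℕ l} →
                                    StrictlyIncreasing (x ∷ xs) → IncreasingFrom x (x ∷ xs)
StrictlyIncreasing⇒IncreasingFrom si[x]          = ≤-refl , tt
StrictlyIncreasing⇒IncreasingFrom (si∷ x<y inc) =
  ≤-refl , x<y , proj₂ (StrictlyIncreasing⇒IncreasingFrom inc)

StrictlyIncreasing⇒IncreasingFrom0 : ∀ {l} {xs : Vec ℕ l} → StrictlyIncreasing xs → IncreasingFrom 0 xs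
StrictlyIncreasing⇒IncreasingFrom0 si[]              = tt
StrictlyIncreasing⇒IncreasingFrom0 {xs = x ∷ xs} inc =
  IncreasingFrom-weaken (x ∷ xs) z≤n (StrictlyIncreasing⇒IncreasingFrom inc)

StrictlyIncreasing-map : ∀ {f : ℕ → ℕ} → (∀ {i j} → i < j → f i < f j) →
                         ∀ {l} {xs : Vec ℕ l} → StrictlyIncreasing xs → StrictlyIncreasing (map f xs)
StrictlyIncreasing-map mono si[]          = si[]
StrictlyIncreasing-map mono si[x]         = si[x]
StrictlyIncreasing-map mono (si∷ x<y inc) = si∷ (mono x<y) (StrictlyIncreasing-map mono inc)

StrictlyIncreasing-map⁻ : ∀ {f : ℕ → ℕ} → (∀ {i j} → f i < f j → i < j) →
                          ∀ {l} (xs : Vec ℕ l) → StrictlyIncreasing (map f xs) → StrictlyIncreasing xs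
StrictlyIncreasing-map⁻ cancel []           _             = si[]
StrictlyIncreasing-map⁻ cancel (x ∷ [])     _             = si[x]
StrictlyIncreasing-map⁻ cancel (x ∷ y ∷ xs) (si∷ fx<fy inc) =
  si∷ (cancel fx<fy) (StrictlyIncreasing-map⁻ cancel (y ∷ xs) inc)

AllIn-map : ∀ {f : ℕ → ℕ} {H} → (∀ i → f i ∈S H) → ∀ {l} (xs : Vec ℕ l) → AllIn (map f xs) H
AllIn-map f∈H []       = tt
AllIn-map f∈H (x ∷ xs) = f∈H x , AllIn-map f∈H xs

range : ℕ → (l : ℕ) → Vec ℕ l
range a zero    = []
range a (suc l) = a ∷ range (suc a) l

range-++-IncreasingFrom : ∀ {k lo} a l (xs : Vec ℕ k) → lo ≤ a → IncreasingFrom (a + l) xs →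
                          IncreasingFrom lo (range a l ++ xs)
range-++-IncreasingFrom a zero    xs lo≤a inc =
  IncreasingFrom-weaken xs (≤-trans lo≤a (≤-reflexive (sym (+-identityʳ a)))) inc
range-++-IncreasingFrom a (suc l) xs lo≤a inc =
  lo≤a , range-++-IncreasingFrom (suc a) l xs ≤-refl (subst (λ b → IncreasingFrom b xs) (+-suc a l) inc)

vsum-++ : ∀ {a b} (xs : Vec ℕ a) (ys : Vec ℕ b) → vsum (xs ++ ys) ≡ vsum xs + vsum ys
vsum-++ []       ys = refl
vsum-++ (x ∷ xs) ys = trans (cong (x +_) (vsum-++ xs ys)) (sym (+-assoc x _ _))

vsum-map-range : ∀ (f : ℕ → ℕ) a l → vsum (map f (range a l)) ≡ sumBelow (λ i → f (a + i)) l
vsum-map-range f a zero    = refl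
vsum-map-range f a (suc l) = begin
  f a + vsum (map f (range (suc a) l))        ≡⟨ cong (f a +_) (vsum-map-range f (suc a) l) ⟩
  f a + sumBelow (λ i → f (suc a + i)) l
    ≡⟨ cong₂ _+_ (cong f (sym (+-identityʳ a))) (sumBelow-cong (λ i → cong f (sym (+-suc a i))) l) ⟩
  f (a + 0) + sumBelow (λ i → f (a + suc i)) l ≡⟨ sym (sumBelow-suc (λ i → f (a + i)) l) ⟩
  sumBelow (λ i → f (a + i)) (suc l)           ∎
  where open ≡-Reasoning

module Enumeration (H : ℕ → Bool) (H-infinite : Infinite H) where

  open Computability (χ H)

  gap : ℕ → ℕ → ℕ
  gap r y = (1 ∸ χ H y) + (r ∸ y)

  gap≡0⇒ : ∀ r y → gap r y ≡ 0 → y ∈S H × r ≤ y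
  gap≡0⇒ r y gap≡0 =
    1∸χ≡0⇒∈ H y (m+n≡0⇒m≡0 _ gap≡0) , m∸n≡0⇒m≤n (m+n≡0⇒n≡0 (1 ∸ χ H y) gap≡0)

  ∈⇒gap≡0 : ∀ {r y} → y ∈S H → r ≤ y → gap r y ≡ 0
  ∈⇒gap≡0 {y = y} y∈H r≤y = cong₂ _+_ (cong (1 ∸_) (χ-true H y y∈H)) (m≤n⇒m∸n≡0 r≤y)

  leastAbove : ∀ r → ∃ (IsLeastZero (gap r))
  leastAbove r with H-infinite r
  ... | b , r<b , b∈H = leastZero (gap r) b (∈⇒gap≡0 b∈H (<⇒≤ r<b))

  next : ℕ → ℕ
  next r = proj₁ (leastAbove r)

  next-∈ : ∀ r → next r ∈S H
  next-∈ r = proj₁ (gap≡0⇒ r _ (proj₁ (proj₂ (leastAbove r))))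

  ≤-next : ∀ r → r ≤ next r
  ≤-next r = proj₂ (gap≡0⇒ r _ (proj₁ (proj₂ (leastAbove r))))

  element : ℕ → ℕ
  element zero    = next 0
  element (suc i) = next (suc (element i))

  element-∈ : ∀ i → element i ∈S H
  element-∈ zero    = next-∈ 0
  element-∈ (suc i) = next-∈ (suc (element i))

  element-suc : ∀ i → element i < element (suc i)
  element-suc i = ≤-next (suc (element i))

  nextᶜ : Computable 1 (unary next)
  nextᶜ = minimise gapᶜ (unary next) (λ xs → proj₂ (leastAbove (lookup xs fzero)))
    where
    gapᶜ : Computable 2 (binary λ y r → gap r y)
    gapᶜ = (constᶜ 1 ∸ᶜ compose₁ oracleᶜ (projᶜ fzero)) +ᶜ (projᶜ (fsuc fzero) ∸ᶜ projᶜ fzero)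

  elementᶜ : Computable 1 (unary element)
  elementᶜ = primRec (compose₁ nextᶜ zeroᶜ) (compose₁ nextᶜ (compose₁ sucᶜ (projᶜ (fsuc fzero))))
               (unary element) (λ _ → refl) (λ _ _ → refl)

module Blocks {e : ℕ → ℕ} (e-suc : ∀ i → e i < e (suc i)) (d : ℕ) where

  module E = IncreasingSequence e-suc

  blockSum : ℕ → ℕ
  blockSum j = sumBelow (λ i → e (j * suc d + i)) (suc d)

  blockSum-suc : ∀ j → blockSum j < blockSum (suc j)
  blockSum-suc j =
    +-mono-≤-< (sumBelow-mono-≤ (λ i → E.mono-≤ (+-monoˡ-≤ i (*-monoˡ-≤ (suc d) (n≤1+n j)))) d)
               (E.mono-< (+-monoˡ-< d (*-monoˡ-< (suc d) (n<1+n j))))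

  module B = IncreasingSequence blockSum-suc

  blockSum-positive : 0 < e 0 → ∀ j → 0 < blockSum j
  blockSum-positive 0<e0 j = ≤-trans 0<e0 (≤-trans (E.mono-≤ z≤n) (m≤n+m _ _))

  -- since j ≤ blockSum j, any block sum equal to x has index below suc x
  occurrences : ℕ → ℕ
  occurrences x = sumBelow (λ j → δ (blockSum j) x) (suc x)

  blockSet : ℕ → Bool
  blockSet x = 0 <ᵇ occurrences x

  blockSet-sound : ∀ x → x ∈S blockSet → ∃[ j ] blockSum j ≡ x
  blockSet-sound x x∈ with sumBelow-positive⁻ _ (suc x) (<ᵇ⇒< 0 _ (Equivalence.from T-≡ x∈))
  ... | j , 0<δ = j , δ-positive⇒≡ _ _ 0<δ

  blockSum-∈ : ∀ j → blockSum j ∈S blockSet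
  blockSum-∈ j = Equivalence.to T-≡ (<⇒<ᵇ (sumBelow-positive (suc (blockSum j)) (s≤s (B.n≤f[n] j))
                                                            (≤-reflexive (sym (δ-refl (blockSum j))))))

  blockSet-0 : 0 < e 0 → blockSet 0 ≡ false
  blockSet-0 0<e0 = ¬-not λ 0∈ → let j , j↦0 = blockSet-sound 0 0∈ in
                                 <-irrefl (sym j↦0) (blockSum-positive 0<e0 j)

  blockSet-infinite : Infinite blockSet
  blockSet-infinite a = blockSum (suc a) , B.n≤f[n] (suc a) , blockSum-∈ (suc a)

  blockSet-indices : ∀ {l} (xs : Vec ℕ l) → AllIn xs blockSet → ∃[ js ] map blockSum js ≡ xs
  blockSet-indices []       _           = [] , refl
  blockSet-indices (x ∷ xs) (x∈ , xs∈) with blockSet-sound x x∈ | blockSet-indices xs xs∈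
  ... | j , refl | js , refl = j ∷ js , refl

  blockIndices : ∀ {l} → Vec ℕ l → Vec ℕ (l * suc d)
  blockIndices []       = []
  blockIndices (j ∷ js) = range (j * suc d) (suc d) ++ blockIndices js

  blockIndices-IncreasingFrom : ∀ {l} lo (js : Vec ℕ l) → IncreasingFrom lo js →
                                IncreasingFrom (lo * suc d) (blockIndices js)
  blockIndices-IncreasingFrom lo []       _            = tt
  blockIndices-IncreasingFrom lo (j ∷ js) (lo≤j , inc) =
    range-++-IncreasingFrom (j * suc d) (suc d) (blockIndices js) (*-monoˡ-≤ (suc d) lo≤j)
      (subst (λ b → IncreasingFrom b (blockIndices js)) (+-comm (suc d) (j * suc d))
             (blockIndices-IncreasingFrom (suc j) js inc))

  vsum-blockIndices : ∀ {l} (js : Vec ℕ l) → vsum (map e (blockIndices js)) ≡ vsum (map blockSum js)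
  vsum-blockIndices []       = refl
  vsum-blockIndices (j ∷ js) = begin
    vsum (map e (range (j * suc d) (suc d) ++ blockIndices js))
      ≡⟨ cong vsum (map-++ e (range (j * suc d) (suc d)) (blockIndices js)) ⟩
    vsum (map e (range (j * suc d) (suc d)) ++ map e (blockIndices js))
      ≡⟨ vsum-++ (map e (range (j * suc d) (suc d))) _ ⟩
    vsum (map e (range (j * suc d) (suc d))) + vsum (map e (blockIndices js))
      ≡⟨ cong₂ _+_ (vsum-map-range e (j * suc d) (suc d)) (vsum-blockIndices js) ⟩
    blockSum j + vsum (map blockSum js) ∎
    where open ≡-Reasoning

  FS-blockSet⇒FS : ∀ {H} → (∀ i → e i ∈S H) →
                   ∀ {l} s → InFS= l blockSet s → InFS= (l * suc d) H s
  FS-blockSet⇒FS e∈H s (xs , xs-inc , xs∈ , Σxs≡s) with blockSet-indices xs xs∈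
  ... | js , refl = map e (blockIndices js) , StrictlyIncreasing-map E.mono-< indices-inc ,
                    AllIn-map e∈H (blockIndices js) , trans (vsum-blockIndices js) Σxs≡s
    where
    indices-inc : StrictlyIncreasing (blockIndices js)
    indices-inc = IncreasingFrom⇒StrictlyIncreasing _ (blockIndices-IncreasingFrom 0 js
                    (StrictlyIncreasing⇒IncreasingFrom0 (StrictlyIncreasing-map⁻ B.cancel-< js xs-inc)))

  module _ {O : ℕ → ℕ} (eᶜ : Computability.Computable O 1 (unary e)) where

    open Computability O

    blockSumᶜ : Computable 1 (unary blockSum)
    blockSumᶜ = compose₂ (sumBelowᶜ {F = λ i j → e (j * suc d + i)}
                           (compose₁ eᶜ (projᶜ (fsuc fzero) *ᶜ constᶜ (suc d) +ᶜ projᶜ fzero)))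
                         (constᶜ (suc d)) (projᶜ fzero)

    occurrencesᶜ : Computable 1 (unary occurrences)
    occurrencesᶜ = compose₂ (sumBelowᶜ {F = λ j x → δ (blockSum j) x} δᶜ)
                            (compose₁ sucᶜ (projᶜ fzero)) (projᶜ fzero)
      where
      blockSum₀ = compose₁ blockSumᶜ (projᶜ fzero)
      x₁ = projᶜ (fsuc fzero)
      δᶜ = constᶜ 1 ∸ᶜ ((blockSum₀ ∸ᶜ x₁) +ᶜ (x₁ ∸ᶜ blockSum₀))

    blockSet≤T : χ blockSet ≤T O
    blockSet≤T = Computable⇒≤T (computable-cong (constᶜ 1 ∸ᶜ (constᶜ 1 ∸ᶜ occurrencesᶜ))
                                                λ { (x ∷ []) → sym (χ-<ᵇ blockSet x (occurrences x) refl) })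

≤T-refl : ∀ A → A ≤T A
≤T-refl A = oracleC , λ _ → evOracle

blockSolution : ∀ {k} n d (f : ℕ → Fin k) H → IsHTSolution (n * suc d) f H →
                Σ (ℕ → Bool) λ H' → IsHTSolution n f H' × χ H' ≤T χ H
blockSolution n d f H (H0 , H-infinite , c , monochromatic) =
  blockSet ,
  (blockSet-0 0<element0 , blockSet-infinite , c ,
   λ s s∈FS → monochromatic s (FS-blockSet⇒FS element-∈ s s∈FS)) ,
  blockSet≤T elementᶜ
  where
  open Enumeration H H-infinite
  open Blocks element-suc d

  0<element0 : 0 < element 0
  0<element0 = n≢0⇒n>0 λ element0≡0 →
    contradiction (trans (sym (subst (_∈S H) element0≡0 (element-∈ 0))) H0) λ ()

mainTheorem8 : ∀ (n m k : ℕ) → 2 ≤ n → 2 ≤ m → 2 ≤ k → n ∣ m →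
    HTStrongReduces k n m
mainTheorem8 n m k _ 2≤m _ (divides zero m≡0) f = contradiction (≤-trans 2≤m (≤-reflexive m≡0)) λ ()
mainTheorem8 n m k _ _ _ (divides (suc d) m≡[1+d]n) f =
  f , ≤T-refl (encColor f) ,
  λ H H-solution → blockSolution n d f H
                     (subst (λ l → IsHTSolution l f H) (trans m≡[1+d]n (*-comm (suc d) n)) H-solution)
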